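{- Let $G$ be a $k$-regular graph of order $n\geqslant 5$, and let $\overline{G}$ be its complement. Then: (1) if $k>n/2$ or $k<(n-2)/2$, then $n+1\leqslant \chi_i(G)+\chi_i(\overline{G})\leqslant 2n$; (2) if $k=n/2$ or $k=(n-2)/2$, then $n\leqslant \chi_i(G)+\chi_i(\overline{G})\leqslant 2n$.
   Context: All graphs are finite and simple; the order of a graph is its number of vertices, and $\overline{G}$ denotes the complement of $G$. A mapping $f:V(G)\to\{1,\ldots,k\}$ is an injective $k$-coloring of $G$ if $f(u)\neq f(v)$ whenever the distinct vertices $u$ and $v$ have a common neighbor in $G$ (adjacent vertices without a common neighbor may receive the same color). The injective chromatic number $\chi_i(G)$ is the minimum $k$ such that $G$ has an injective $k$-coloring. -}

module Defs where

open import Data.Nat using (ℕ; _≤_; _<_)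
open import Data.Bool using (Bool; true; false; not)
open import Data.Fin using (Fin)
open import Data.Fin.Properties using (_≟_)
open import Data.List using (List; length; filter; allFin)
open import Data.Product using (Σ; ∃; _×_; _,_)
open import Relation.Binary.PropositionalEquality using (_≡_; _≢_)
open import Relation.Nullary using (¬_)
open import Data.Bool.Properties using (T?)
open import Data.Bool using (T)

record Graph (n : ℕ) : Set where
  field
    adj   : Fin n → Fin n → Bool
    sym   : ∀ u v → adj u v ≡ adj v u
    irrfl : ∀ v → adj v v ≡ false
open Graph public

Adj : ∀ {n} → Graph n → Fin n → Fin n → Set
Adj G u v = T (adj G u v)

compl : ∀ {n} → Graph n → Graph n
compl {n} G = record { adj = cadj ; sym = csym ; irrfl = cirr }
  where
  cadj : Fin n → Fin n → Bool
  cadj u v with u ≟ v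
  ... | Relation.Nullary.yes _ = false
  ... | Relation.Nullary.no  _ = not (adj G u v)
  csym : ∀ u v → cadj u v ≡ cadj v u
  csym u v with u ≟ v | v ≟ u
  ... | Relation.Nullary.yes _  | Relation.Nullary.yes _  = Relation.Binary.PropositionalEquality.refl
  ... | Relation.Nullary.yes p  | Relation.Nullary.no ¬q  = Data.Empty.⊥-elim (¬q (Relation.Binary.PropositionalEquality.sym p))
    where import Data.Empty
  ... | Relation.Nullary.no ¬p  | Relation.Nullary.yes q  = Data.Empty.⊥-elim (¬p (Relation.Binary.PropositionalEquality.sym q))
    where import Data.Empty
  ... | Relation.Nullary.no _   | Relation.Nullary.no _   = Relation.Binary.PropositionalEquality.cong not (sym G u v)
  cirr : ∀ v → cadj v v ≡ false
  cirr v with v ≟ v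
  ... | Relation.Nullary.yes _ = Relation.Binary.PropositionalEquality.refl
  ... | Relation.Nullary.no ¬p = Data.Empty.⊥-elim (¬p Relation.Binary.PropositionalEquality.refl)
    where import Data.Empty

degree : ∀ {n} → Graph n → Fin n → ℕ
degree G v = length (filter (λ u → T? (adj G v u)) (allFin _))

Regular : ∀ {n} → Graph n → ℕ → Set
Regular G k = ∀ v → degree G v ≡ k

InjectiveColoring : ∀ {n} → Graph n → (k : ℕ) → (Fin n → Fin k) → Set
InjectiveColoring {n} G k f =
  ∀ (u v : Fin n) → u ≢ v → (∃ λ w → Adj G u w × Adj G v w) → f u ≢ f v

InjColorable : ∀ {n} → Graph n → ℕ → Set
InjColorable {n} G k = Σ (Fin n → Fin k) (InjectiveColoring G k)

IsInjChromaticNumber : ∀ {n} → Graph n → ℕ → Set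
IsInjChromaticNumber G c = InjColorable G c × (∀ k → InjColorable G k → c ≤ k)

-- Call a set of vertices *linked* if any two of them have a common neighbour;
-- an injective colouring is injective on a linked set, so linked sets bound
-- χᵢ from below, while the identity colouring gives χᵢ ≤ n.
module Submission where

open import Defs hiding (sym)
open import Data.Nat using (ℕ; zero; suc; _≤_; _<_; _+_; _*_; z≤n; s≤s)
open import Data.Nat.Properties
  using (≤-trans; ≤-reflexive; ≤-antisym; ≤-pred; ≮⇒≥; <⇒≱; 1+n≰n; m≤n⇒m≤1+n; n≤1+n;
         +-comm; +-assoc; +-suc; +-identityʳ; +-mono-≤; +-monoʳ-≤; +-monoʳ-<; +-cancelʳ-<; +-cancelʳ-≡;
         module ≤-Reasoning)
open import Data.Nat.Tactic.RingSolver using (solve-∀)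
open import Data.Bool using (Bool; true; false; not; _∨_; T)
open import Data.Bool.Properties using (T?; T-∨; not-involutive)
open import Data.Unit using (tt)
open import Data.Empty using (⊥; ⊥-elim)
open import Data.List using (List; []; _∷_; length; filter; allFin; lookup)
open import Data.List.Properties using (length-filter; length-tabulate)
open import Data.List.Membership.Propositional using (_∈_)
open import Data.List.Membership.Propositional.Properties using (∈-filter⁻; ∈-lookup; ∈-allFin)
open import Data.List.Relation.Unary.Any using (here; there)
import Data.List.Relation.Unary.All as All
open import Data.List.Relation.Unary.AllPairs using (_∷_)
open import Data.List.Relation.Unary.Unique.Propositional using (Unique)
import Data.List.Relation.Unary.Unique.Propositional.Properties as Unique
open import Data.Fin using (Fin; zero; suc; fromℕ<)
open import Data.Fin.Properties using (_≟_; injective⇒≤; any?)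
open import Data.Product using (_×_; _,_; proj₁; proj₂; ∃)
open import Data.Sum using (_⊎_; inj₁; inj₂; [_,_]′)
open import Function using (_∘_)
open import Function.Bundles using (Equivalence)
open import Relation.Binary.PropositionalEquality
  using (_≡_; _≢_; refl; sym; trans; cong; cong₂; subst; subst₂; module ≡-Reasoning)
open import Relation.Nullary using (¬_; Dec; yes; no; ¬?)
open import Relation.Nullary.Decidable using (⌊_⌋; _×-dec_; decidable-stable)

enlarged-left : ∀ {d h n a b} → d + h + 1 ≡ n → h + 1 ≤ a → d ≤ b → n ≤ a + b
enlarged-left {d} {h} {n} {a} {b} sizes h<a d≤b =
  subst (_≤ a + b) (trans (reorder d h) sizes) (+-mono-≤ h<a d≤b)
  where
  reorder : ∀ d h → h + 1 + d ≡ d + h + 1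
  reorder = solve-∀

enlarged-right : ∀ {d h n a b} → d + h + 1 ≡ n → h ≤ a → d + 1 ≤ b → n ≤ a + b
enlarged-right {d} {h} {n} {a} {b} sizes h≤a d<b =
  subst (_≤ a + b) (trans (reorder d h) sizes) (+-mono-≤ h≤a d<b)
  where
  reorder : ∀ d h → h + (d + 1) ≡ d + h + 1
  reorder = solve-∀

plus-one : ∀ {n a b} → n ≤ a → 1 ≤ b → suc n ≤ a + b
plus-one {n} {a} {b} n≤a 1≤b = subst (_≤ a + b) (+-comm n 1) (+-mono-≤ n≤a 1≤b)

at-most-double : ∀ {n a b} → a ≤ n → b ≤ n → a + b ≤ 2 * n
at-most-double {n} {a} {b} a≤n b≤n =
  subst (a + b ≤_) (cong (n +_) (sym (+-identityʳ n))) (+-mono-≤ a≤n b≤n)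

twice : ∀ k → 2 * k ≡ k + k
twice k = cong (k +_) (+-identityʳ k)

half-≥3 : ∀ {h n} → h + h ≡ n → 5 ≤ n → 3 ≤ h
half-≥3 half 5≤n = ≮⇒≥ λ h<3 →
  <⇒≱ 5≤n (subst (_≤ 4) half (+-mono-≤ (≤-pred h<3) (≤-pred h<3)))

complement-dense : ∀ {d k n} → d + k + 1 ≡ n → 2 * k + 2 < n → n < d + d
complement-dense {d} {k} {n} sizes 2k+2<n = +-cancelʳ-< (2 * k + 2) n (d + d) (begin-strict
  n + (2 * k + 2)              <⟨ +-monoʳ-< n 2k+2<n ⟩
  n + n                        ≡⟨ cong₂ _+_ (sym sizes) (sym sizes) ⟩
  (d + k + 1) + (d + k + 1)    ≡⟨ regroup d k ⟩
  d + d + (2 * k + 2)          ∎)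
  where
  open ≤-Reasoning
  regroup : ∀ d k → (d + k + 1) + (d + k + 1) ≡ d + d + (2 * k + 2)
  regroup = solve-∀

count : ∀ {A : Set} → List A → (A → Bool) → ℕ
count xs p = length (filter (λ x → T? (p x)) xs)

_∪_ : ∀ {A : Set} → (A → Bool) → (A → Bool) → A → Bool
(p ∪ q) x = p x ∨ q x

∨-split : ∀ a {b} → T (a ∨ b) → T a ⊎ T b
∨-split a = Equivalence.to T-∨

∨-introˡ : ∀ {a} b → T a → T (a ∨ b)
∨-introˡ b = Equivalence.from T-∨ ∘ inj₁

∨-introʳ : ∀ a {b} → T b → T (a ∨ b)
∨-introʳ a = Equivalence.from T-∨ ∘ inj₂

Disjoint : ∀ {A : Set} → (A → Bool) → (A → Bool) → Set
Disjoint p q = ∀ x → T (p x) → T (q x) → ⊥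

module _ {A : Set} where

  count-mono : ∀ (xs : List A) p q → (∀ x → T (p x) → T (q x)) → count xs p ≤ count xs q
  count-mono []       p q p⊆q = z≤n
  count-mono (x ∷ xs) p q p⊆q with p x in px | q x in qx
  ... | true  | true  = s≤s (count-mono xs p q p⊆q)
  ... | true  | false = ⊥-elim (subst T qx (p⊆q x (subst T (sym px) tt)))
  ... | false | true  = m≤n⇒m≤1+n (count-mono xs p q p⊆q)
  ... | false | false = count-mono xs p q p⊆q

  count-disjoint : ∀ (xs : List A) p q → Disjoint p q → count xs p + count xs q ≤ count xs (p ∪ q)
  count-disjoint []       p q disj = z≤n
  count-disjoint (x ∷ xs) p q disj with p x in px | q x in qx
  ... | true  | true  = ⊥-elim (disj x (subst T (sym px) tt) (subst T (sym qx) tt))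
  ... | true  | false = s≤s (count-disjoint xs p q disj)
  ... | false | true  = ≤-trans (≤-reflexive (+-suc (count xs p) (count xs q)))
                                (s≤s (count-disjoint xs p q disj))
  ... | false | false = count-disjoint xs p q disj

  count-∪ : ∀ (xs : List A) p q → count xs (p ∪ q) ≤ count xs p + count xs q
  count-∪ []       p q = z≤n
  count-∪ (x ∷ xs) p q with p x | q x
  ... | true  | true  = s≤s (≤-trans (count-∪ xs p q) (+-monoʳ-≤ (count xs p) (n≤1+n _)))
  ... | true  | false = s≤s (count-∪ xs p q)
  ... | false | true  = ≤-trans (s≤s (count-∪ xs p q))
                                (≤-reflexive (sym (+-suc (count xs p) (count xs q))))
  ... | false | false = count-∪ xs p q

  count-true : ∀ (xs : List A) → count xs (λ _ → true) ≡ length xs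
  count-true []       = refl
  count-true (x ∷ xs) = cong suc (count-true xs)

  count-member : ∀ {xs : List A} p {x} → x ∈ xs → T (p x) → 1 ≤ count xs p
  count-member {y ∷ xs} p (here refl) py with p y
  ... | true = s≤s z≤n
  count-member {y ∷ xs} p (there x∈xs) px with p y
  ... | true  = s≤s z≤n
  ... | false = count-member p x∈xs px

  lookup-distinct : ∀ (xs : List A) → Unique xs → ∀ i j → i ≢ j → lookup xs i ≢ lookup xs j
  lookup-distinct (x ∷ xs) (x∉ ∷ u) zero    zero    i≢j = ⊥-elim (i≢j refl)
  lookup-distinct (x ∷ xs) (x∉ ∷ u) zero    (suc j) _   = All.lookup x∉ (∈-lookup j)
  lookup-distinct (x ∷ xs) (x∉ ∷ u) (suc i) zero    _   = All.lookup x∉ (∈-lookup i) ∘ sym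
  lookup-distinct (x ∷ xs) (x∉ ∷ u) (suc i) (suc j) i≢j = lookup-distinct xs u i j (i≢j ∘ cong suc)

  count-separated : ∀ (xs : List A) → Unique xs → ∀ p {a} (f : A → Fin a) →
                    (∀ x y → T (p x) → T (p y) → x ≢ y → f x ≢ f y) → count xs p ≤ a
  count-separated xs u p f sep = injective⇒≤ {f = f ∘ lookup L} separates
    where
    P? = λ x → T? (p x)
    L = filter P? xs
    inL : ∀ i → T (p (lookup L i))
    inL i = proj₂ (∈-filter⁻ P? {xs = xs} (∈-lookup i))
    separates : ∀ {i j} → f (lookup L i) ≡ f (lookup L j) → i ≡ j
    separates {i} {j} same = decidable-stable (i ≟ j) λ i≢j →
      sep _ _ (inL i) (inL j) (lookup-distinct L (Unique.filter⁺ P? u) i j i≢j) same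

module _ {n : ℕ} where

  ∣_∣ : (Fin n → Bool) → ℕ
  ∣ p ∣ = count (allFin n) p

  size-≤ : ∀ p → ∣ p ∣ ≤ n
  size-≤ p = subst (∣ p ∣ ≤_) (length-tabulate (λ x → x)) (length-filter (λ x → T? (p x)) (allFin n))

  size-true : ∣ (λ _ → true) ∣ ≡ n
  size-true = trans (count-true (allFin n)) (length-tabulate (λ x → x))

  size-full : ∀ p → (∀ x → T (p x)) → n ≤ ∣ p ∣
  size-full p all = subst (_≤ ∣ p ∣) size-true (count-mono (allFin n) (λ _ → true) p (λ x _ → all x))

  size-disjoint-∪ : ∀ p q → Disjoint p q → ∣ p ∪ q ∣ ≡ ∣ p ∣ + ∣ q ∣
  size-disjoint-∪ p q disj =
    ≤-antisym (count-∪ (allFin n) p q) (count-disjoint (allFin n) p q disj)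

  disjoint-size-≤ : ∀ p q → Disjoint p q → ∣ p ∣ + ∣ q ∣ ≤ n
  disjoint-size-≤ p q disj = subst (_≤ n) (size-disjoint-∪ p q disj) (size-≤ (p ∪ q))

  size-partition : ∀ p q → Disjoint p q → (∀ x → T ((p ∪ q) x)) → ∣ p ∣ + ∣ q ∣ ≡ n
  size-partition p q disj cover =
    trans (sym (size-disjoint-∪ p q disj)) (≤-antisym (size-≤ (p ∪ q)) (size-full (p ∪ q) cover))

  size-separated : ∀ p {a} (f : Fin n → Fin a) →
                   (∀ x y → T (p x) → T (p y) → x ≢ y → f x ≢ f y) → ∣ p ∣ ≤ a
  size-separated = count-separated (allFin n) (Unique.allFin⁺ n)

  is : Fin n → Fin n → Bool
  is u x = ⌊ x ≟ u ⌋

  is-sound : ∀ {u x} → T (is u x) → x ≡ u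
  is-sound {u} {x} t with x ≟ u
  ... | yes x≡u = x≡u

  is-complete : ∀ {u x} → x ≡ u → T (is u x)
  is-complete {u} {x} x≡u with x ≟ u
  ... | yes _   = tt
  ... | no x≢u = x≢u x≡u

  size-is : ∀ u → ∣ is u ∣ ≡ 1
  size-is u = ≤-antisym (size-separated (is u) (λ _ → zero) distinct)
                        (count-member (is u) (∈-allFin u) (is-complete refl))
    where
    distinct : ∀ x y → T (is u x) → T (is u y) → x ≢ y → zero ≢ zero
    distinct x y x≡u y≡u x≢y _ = x≢y (trans (is-sound x≡u) (sym (is-sound y≡u)))

  size-insert : ∀ p z → ¬ T (p z) → ∣ p ∪ is z ∣ ≡ ∣ p ∣ + 1
  size-insert p z z∉p = trans (size-disjoint-∪ p (is z) disjoint) (cong (∣ p ∣ +_) (size-is z))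
    where
    disjoint : Disjoint p (is z)
    disjoint x px x≡z = z∉p (subst (T ∘ p) (is-sound x≡z) px)

  size-avoid : ∀ p u₁ u₂ → 3 ≤ ∣ p ∣ → ∃ λ x → T (p x) × x ≢ u₁ × x ≢ u₂
  size-avoid p u₁ u₂ three with any? (λ x → T? (p x) ×-dec (¬? (x ≟ u₁) ×-dec ¬? (x ≟ u₂)))
  ... | yes found = found
  ... | no none   = ⊥-elim (<⇒≱ three (begin
    ∣ p ∣                 ≤⟨ count-mono (allFin n) p (is u₁ ∪ is u₂) inPair ⟩
    ∣ is u₁ ∪ is u₂ ∣     ≤⟨ count-∪ (allFin n) (is u₁) (is u₂) ⟩
    ∣ is u₁ ∣ + ∣ is u₂ ∣ ≡⟨ cong₂ _+_ (size-is u₁) (size-is u₂) ⟩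
    2                     ∎))
    where
    open ≤-Reasoning
    inPair : ∀ x → T (p x) → T ((is u₁ ∪ is u₂) x)
    inPair x px with x ≟ u₁ | x ≟ u₂
    ... | yes _  | _      = tt
    ... | no _   | yes _  = tt
    ... | no x≢₁ | no x≢₂ = none (x , px , x≢₁ , x≢₂)

module _ {n : ℕ} where

  CommonNeighbour : Graph n → Fin n → Fin n → Set
  CommonNeighbour H u v = ∃ λ w → Adj H u w × Adj H v w

  common? : ∀ (H : Graph n) u v → Dec (CommonNeighbour H u v)
  common? H u v = any? (λ w → T? (adj H u w) ×-dec T? (adj H v w))

  common-sym : ∀ {H : Graph n} {u v} → CommonNeighbour H u v → CommonNeighbour H v u
  common-sym (w , uw , vw) = w , vw , uw

  disjoint-neighbourhoods : ∀ (H : Graph n) {u v} → ¬ CommonNeighbour H u v → Disjoint (adj H u) (adj H v)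
  disjoint-neighbourhoods H ¬uv x ux vx = ¬uv (x , ux , vx)

  adj-sym : ∀ {H : Graph n} {u v} → Adj H u v → Adj H v u
  adj-sym {H = H} {u} {v} = subst T (Graph.sym H u v)

  adj-≢ : ∀ {H : Graph n} {u v} → Adj H u v → u ≢ v
  adj-≢ {H = H} {u} uu refl = subst T (irrfl H u) uu

  record IsComplement (H H' : Graph n) : Set where
    field complement : ∀ u v → u ≢ v → adj H' u v ≡ not (adj H u v)
  open IsComplement

  compl-isComplement : ∀ (G : Graph n) → IsComplement G (compl G)
  compl-isComplement G .complement u v u≢v with u ≟ v
  ... | yes u≡v = ⊥-elim (u≢v u≡v)
  ... | no _    = refl

  isComplement-sym : ∀ {H H' : Graph n} → IsComplement H H' → IsComplement H' H
  isComplement-sym {H} {H'} c .complement u v u≢v =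
    trans (sym (not-involutive (adj H u v))) (cong not (sym (complement c u v u≢v)))

  module _ {H H' : Graph n} (c : IsComplement H H') where

    complement-nonadj : ∀ {u v} → Adj H' u v → ¬ Adj H u v
    complement-nonadj {u} {v} uv' uv with adj H u v | complement c u v (adj-≢ {H = H'} uv')
    ... | true | H'uv≡false = subst T H'uv≡false uv'

    complement-adj : ∀ {u v} → u ≢ v → ¬ Adj H u v → Adj H' u v
    complement-adj {u} {v} u≢v ¬uv with adj H u v | complement c u v u≢v
    ... | true  | _          = ⊥-elim (¬uv tt)
    ... | false | H'uv≡true = subst T (sym H'uv≡true) tt

    complement-cover : ∀ {x y} → ¬ CommonNeighbour H' x y →
                       ∀ u → u ≢ x → u ≢ y → Adj H x u ⊎ Adj H y u
    complement-cover {x} {y} noCommon u u≢x u≢y with T? (adj H x u) | T? (adj H y u)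
    ... | yes xu  | _       = inj₁ xu
    ... | no _    | yes yu  = inj₂ yu
    ... | no ¬xu  | no ¬yu  =
      ⊥-elim (noCommon (u , complement-adj (u≢x ∘ sym) ¬xu , complement-adj (u≢y ∘ sym) ¬yu))

    complement-degrees : ∀ v → degree H' v + degree H v + 1 ≡ n
    complement-degrees v = begin
      degree H' v + degree H v + 1
        ≡⟨ cong₂ _+_ (sym (size-disjoint-∪ (adj H' v) (adj H v) notBoth)) (sym (size-is v)) ⟩
      ∣ adj H' v ∪ adj H v ∣ + ∣ is v ∣
        ≡⟨ size-partition (adj H' v ∪ adj H v) (is v) notSelf cover ⟩
      n ∎
      where
      open ≡-Reasoning
      notBoth : Disjoint (adj H' v) (adj H v)
      notBoth x vx' vx = complement-nonadj vx' vx
      notSelf : Disjoint (adj H' v ∪ adj H v) (is v)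
      notSelf x vx x≡v with ∨-split (adj H' v x) vx | is-sound x≡v
      ... | inj₁ vv' | refl = adj-≢ {H = H'} vv' refl
      ... | inj₂ vv  | refl = adj-≢ {H = H} vv refl
      cover : ∀ x → T (((adj H' v ∪ adj H v) ∪ is v) x)
      cover x with T? (is v x)
      ... | yes x≡v = ∨-introʳ (adj H' v x ∨ adj H v x) x≡v
      ... | no x≢v with T? (adj H v x)
      ...   | yes vx = ∨-introˡ (is v x) (∨-introʳ (adj H' v x) vx)
      ...   | no ¬vx = ∨-introˡ (is v x)
                         (∨-introˡ (adj H v x) (complement-adj (x≢v ∘ is-complete ∘ sym) ¬vx))

module _ {n : ℕ} where

  Linked : Graph n → (Fin n → Bool) → Set
  Linked H p = ∀ x y → T (p x) → T (p y) → x ≢ y → CommonNeighbour H x y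

  linked-bound : ∀ {H : Graph n} {a f} p → InjectiveColoring H a f → Linked H p → ∣ p ∣ ≤ a
  linked-bound {f = f} p col linked =
    size-separated p f (λ x y px py x≢y → col x y x≢y (linked x y px py x≢y))

  neighbourhood-linked : ∀ (H : Graph n) v → Linked H (adj H v)
  neighbourhood-linked H v x y vx vy _ = v , adj-sym {H = H} vx , adj-sym {H = H} vy

  linked-insert : ∀ {H : Graph n} {p} z → Linked H p → (∀ x → T (p x) → CommonNeighbour H z x) →
                  Linked H (p ∪ is z)
  linked-insert {H} {p} z linked fromZ x y px py x≢y with ∨-split (p x) px | ∨-split (p y) py
  ... | inj₁ x∈p | inj₁ y∈p = linked x y x∈p y∈p x≢y
  ... | inj₁ x∈p | inj₂ y≡z rewrite is-sound y≡z = common-sym {H = H} (fromZ x x∈p)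
  ... | inj₂ x≡z | inj₁ y∈p rewrite is-sound x≡z = fromZ y y∈p
  ... | inj₂ x≡z | inj₂ y≡z = ⊥-elim (x≢y (trans (is-sound x≡z) (sym (is-sound y≡z))))

  linked-insert-bound : ∀ {H : Graph n} {a f p} z → InjectiveColoring H a f → Linked H p → ¬ T (p z) →
                        (∀ x → T (p x) → CommonNeighbour H z x) → ∣ p ∣ + 1 ≤ a
  linked-insert-bound {H} {a} {p = p} z col linked z∉p fromZ =
    subst (_≤ a) (size-insert p z z∉p)
          (linked-bound {H = H} (p ∪ is z) col (linked-insert {H = H} {p = p} z linked fromZ))

  common-or-lonely : ∀ (H : Graph n) (p : Fin n → Bool) z →
                     (∀ x → T (p x) → CommonNeighbour H z x) ⊎
                     (∃ λ x → T (p x) × ¬ CommonNeighbour H z x)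
  common-or-lonely H p z with any? (λ x → T? (p x) ×-dec ¬? (common? H z x))
  ... | yes lonely = inj₂ lonely
  ... | no none    = inj₁ λ x px → decidable-stable (common? H z x) (λ ¬zx → none (x , px , ¬zx))

  degree-bound : ∀ (H : Graph n) {v a f} → InjectiveColoring H a f → degree H v ≤ a
  degree-bound H {v} col = linked-bound {H = H} (adj H v) col (neighbourhood-linked H v)

  closed-neighbourhood-bound : ∀ (H : Graph n) {v a f} → InjectiveColoring H a f →
                               (∀ x → Adj H v x → CommonNeighbour H v x) → degree H v + 1 ≤ a
  closed-neighbourhood-bound H {v} col fromV =
    linked-insert-bound {H = H} v col (neighbourhood-linked H v) (λ vv → adj-≢ {H = H} vv refl) fromV

  chromatic-≤-order : ∀ (H : Graph n) {a} → IsInjChromaticNumber H a → a ≤ n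
  chromatic-≤-order H (_ , minimal) = minimal n ((λ x → x) , λ u v u≢v _ → u≢v)

  colorable-pos : ∀ (H : Graph n) {a} → 1 ≤ n → InjColorable H a → 1 ≤ a
  colorable-pos H {zero}  (s≤s _) (f , _) with f (fromℕ< (s≤s z≤n))
  ... | ()
  colorable-pos H {suc a} _ _ = s≤s z≤n

  module _ (H : Graph n) {h : ℕ} (regular : Regular H h) where

    -- If 2h > n then two neighbourhoods always meet: all of V(H) is linked.
    dense-linked : n < h + h → Linked H (λ _ → true)
    dense-linked n<2h x y _ _ _ = decidable-stable (common? H x y) λ ¬xy →
      <⇒≱ n<2h (subst₂ (λ dx dy → dx + dy ≤ n) (regular x) (regular y)
                  (disjoint-size-≤ (adj H x) (adj H y) (disjoint-neighbourhoods H ¬xy)))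

    dense-bound : ∀ {a f} → n < h + h → InjectiveColoring H a f → n ≤ a
    dense-bound {a} n<2h col =
      subst (_≤ a) size-true (linked-bound {H = H} (λ _ → true) col (dense-linked n<2h))

    dense-pair : ∀ (H' : Graph n) {a b f} → 1 ≤ n → n < h + h →
                 InjectiveColoring H a f → InjColorable H' b → suc n ≤ a + b
    dense-pair H' 1≤n n<2h col col' = plus-one (dense-bound n<2h col) (colorable-pos H' 1≤n col')

    no-strict-superset : ∀ {v x z} → (∀ u → Adj H v u → Adj H x u) → Adj H x z → ¬ Adj H v z → ⊥
    no-strict-superset {v} {x} {z} sub xz ¬vz = 1+n≰n (begin
      suc h                   ≡⟨ +-comm 1 h ⟩
      h + 1                   ≡⟨ cong (_+ 1) (sym (regular v)) ⟩
      ∣ adj H v ∣ + 1         ≡⟨ sym (size-insert (adj H v) z ¬vz) ⟩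
      ∣ adj H v ∪ is z ∣      ≤⟨ count-mono (allFin n) (adj H v ∪ is z) (adj H x) inX ⟩
      ∣ adj H x ∣             ≡⟨ regular x ⟩
      h                       ∎)
      where
      open ≤-Reasoning
      inX : ∀ u → T ((adj H v ∪ is z) u) → Adj H x u
      inX u t with ∨-split (adj H v u) t
      ... | inj₁ vu  = sub u vu
      ... | inj₂ u≡z = subst (Adj H x) (sym (is-sound u≡z)) xz

module Balanced {n : ℕ} {H H' : Graph n} (c : IsComplement H H')
                {h : ℕ} (regular : Regular H h) (half : h + h ≡ n) (three : 3 ≤ h) where

  disjoint-cover : ∀ {v w} → ¬ CommonNeighbour H v w → ∀ u → Adj H v u ⊎ Adj H w u
  disjoint-cover {v} {w} ¬vw u with T? (adj H v u) | T? (adj H w u)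
  ... | yes vu | _      = inj₁ vu
  ... | no _   | yes wu = inj₂ wu
  ... | no ¬vu | no ¬wu = ⊥-elim (1+n≰n (begin
    suc n                            ≡⟨ +-comm 1 n ⟩
    n + 1                            ≡⟨ cong (_+ 1) (sym half) ⟩
    h + h + 1                        ≡⟨ cong (_+ 1) (cong₂ _+_ (sym (regular v)) (sym (regular w))) ⟩
    ∣ adj H v ∣ + ∣ adj H w ∣ + 1    ≡⟨ cong (_+ 1) (sym (size-disjoint-∪ (adj H v) (adj H w)
                                                               (disjoint-neighbourhoods H ¬vw))) ⟩
    ∣ adj H v ∪ adj H w ∣ + 1        ≡⟨ sym (size-insert (adj H v ∪ adj H w) u neither) ⟩
    ∣ (adj H v ∪ adj H w) ∪ is u ∣   ≤⟨ size-≤ ((adj H v ∪ adj H w) ∪ is u) ⟩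
    n                                ∎))
    where
    open ≤-Reasoning
    neither : ¬ T (adj H v u ∨ adj H w u)
    neither t = [ ¬vu , ¬wu ]′ (∨-split (adj H v u) t)

  escape : ∀ {v w x₀ x₁} → Disjoint (adj H v) (adj H w) →
           (∀ u → u ≢ v → u ≢ x₁ → Adj H v u ⊎ Adj H x₁ u) →
           ¬ Adj H v x₁ → ¬ Adj H v x₀ → x₀ ≢ v → ∃ λ z → Adj H x₀ z × ¬ Adj H v z
  escape {v} {w} {x₀} {x₁} disjoint cover ¬vx₁ ¬vx₀ x₀≢v with x₀ ≟ x₁
  ... | no x₀≢x₁ with cover x₀ x₀≢v x₀≢x₁
  ...   | inj₁ vx₀  = ⊥-elim (¬vx₀ vx₀)
  ...   | inj₂ x₁x₀ = x₁ , adj-sym {H = H} x₁x₀ , ¬vx₁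
  escape {v} {w} {x₀} {x₁} disjoint cover ¬vx₁ ¬vx₀ x₀≢v | yes refl
    with size-avoid (adj H w) v x₀ (subst (3 ≤_) (sym (regular w)) three)
  ... | u , wu , u≢v , u≢x₀ with cover u u≢v u≢x₀
  ...   | inj₁ vu  = ⊥-elim (disjoint u vu wu)
  ...   | inj₂ x₀u = u , x₀u , λ vu → disjoint u vu wu

  -- The configuration left open by `balanced-bound` is impossible: otherwise
  -- N(v) ⊊ N(x₀), contradicting regularity.
  no-lonely-triple : ∀ {v w x₀ x₁} → Adj H v w → ¬ CommonNeighbour H v w →
                     Adj H' v x₁ → ¬ CommonNeighbour H' v x₁ →
                     Adj H' v x₀ → ¬ CommonNeighbour H' w x₀ → ⊥
  no-lonely-triple {v} {w} {x₀} {x₁} vw ¬vw vx₁ ¬vx₁ vx₀ ¬wx₀ =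
    no-strict-superset H regular sub x₀z ¬vz
    where
    disjoint : Disjoint (adj H v) (adj H w)
    disjoint = disjoint-neighbourhoods H ¬vw
    ¬vx₀ : ¬ Adj H v x₀
    ¬vx₀ = complement-nonadj c vx₀
    wx₀ : Adj H w x₀
    wx₀ = [ ⊥-elim ∘ ¬vx₀ , (λ wx₀ → wx₀) ]′ (disjoint-cover ¬vw x₀)
    sub : ∀ u → Adj H v u → Adj H x₀ u
    sub u vu with u ≟ w
    ... | yes refl = adj-sym {H = H} wx₀
    ... | no u≢w with complement-cover c ¬wx₀ u u≢w (λ u≡x₀ → ¬vx₀ (subst (Adj H v) u≡x₀ vu))
    ...   | inj₁ wu  = ⊥-elim (disjoint u vu wu)
    ...   | inj₂ x₀u = x₀u
    outside : ∃ λ z → Adj H x₀ z × ¬ Adj H v z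
    outside = escape disjoint (complement-cover c ¬vx₁) (complement-nonadj c vx₁) ¬vx₀
                     (adj-≢ {H = H'} vx₀ ∘ sym)
    z = proj₁ outside
    x₀z = proj₁ (proj₂ outside)
    ¬vz = proj₂ (proj₂ outside)

  -- The neighbourhoods of v give deg v ≤ χᵢ(H) and
  -- deg' v ≤ χᵢ(H'), with deg' v + deg v + 1 = n; unless `no-lonely-triple`
  -- applies, one of these linked sets can be enlarged by a vertex.
  balanced-bound : ∀ (v : Fin n) {a b f g} → InjectiveColoring H a f → InjectiveColoring H' b g → n ≤ a + b
  balanced-bound v colH colH' with common-or-lonely H (adj H v) v
  ... | inj₁ allH =
    enlarged-left (complement-degrees c v) (closed-neighbourhood-bound H colH allH) (degree-bound H' colH')
  ... | inj₂ (w , vw , ¬vw) with common-or-lonely H' (adj H' v) v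
  ...   | inj₁ allH' =
    enlarged-right (complement-degrees c v) (degree-bound H colH) (closed-neighbourhood-bound H' colH' allH')
  ...   | inj₂ (x₁ , vx₁ , ¬vx₁) with common-or-lonely H' (adj H' v) w
  ...     | inj₁ allW = enlarged-right (complement-degrees c v) (degree-bound H colH)
                          (linked-insert-bound {H = H'} w colH' (neighbourhood-linked H' v)
                                               (complement-nonadj (isComplement-sym c) vw) allW)
  ...     | inj₂ (x₀ , vx₀ , ¬wx₀) = ⊥-elim (no-lonely-triple vw ¬vw vx₁ ¬vx₁ vx₀ ¬wx₀)

module _ {n : ℕ} (G : Graph n) {k : ℕ} (regular : Regular G k) where

  complement-degree : ∀ v → degree (compl G) v + k + 1 ≡ n
  complement-degree v = subst (λ d → degree (compl G) v + d + 1 ≡ n) (regular v)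
                              (complement-degrees (compl-isComplement G) v)

  complement-regular : ∀ {d} → d + k + 1 ≡ n → Regular (compl G) d
  complement-regular {d} sizes v = +-cancelʳ-≡ (k + 1) (degree (compl G) v) d (begin
    degree (compl G) v + (k + 1)   ≡⟨ sym (+-assoc (degree (compl G) v) k 1) ⟩
    degree (compl G) v + k + 1     ≡⟨ complement-degree v ⟩
    n                              ≡⟨ sym sizes ⟩
    d + k + 1                      ≡⟨ +-assoc d k 1 ⟩
    d + (k + 1)                    ∎)
    where open ≡-Reasoning

  sparse-complement-dense : ∀ v → 2 * k + 2 < n → let d = degree (compl G) v in Regular (compl G) d × n < d + d
  sparse-complement-dense v 2k+2<n = complement-regular sizes , complement-dense {d} {k} sizes 2k+2<n
    where
    d = degree (compl G) v
    sizes : d + k + 1 ≡ n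
    sizes = complement-degree v

  near-half-complement : 2 * k + 2 ≡ n → Regular (compl G) (suc k) × suc k + suc k ≡ n
  near-half-complement 2k+2≡n =
    complement-regular (trans (regroup₁ k) 2k+2≡n) , trans (regroup₂ k) 2k+2≡n
    where
    regroup₁ : ∀ k → suc k + k + 1 ≡ 2 * k + 2
    regroup₁ = solve-∀
    regroup₂ : ∀ k → suc k + suc k ≡ 2 * k + 2
    regroup₂ = solve-∀

lemma5 : (n k : ℕ) → 5 ≤ n → (G : Graph n) → Regular G k →
         (a b : ℕ) → IsInjChromaticNumber G a → IsInjChromaticNumber (compl G) b →
         ((n < 2 * k ⊎ 2 * k + 2 < n) → (suc n ≤ a + b × a + b ≤ 2 * n))
         × ((2 * k ≡ n ⊎ 2 * k + 2 ≡ n) → (n ≤ a + b × a + b ≤ 2 * n))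
lemma5 n k 5≤n G regular a b χG@((f , colG) , _) χG'@((g , colG') , _) =
  (λ case → dense case , upper) , (λ case → balanced case , upper)
  where
  c = compl-isComplement G
  1≤n = ≤-trans (s≤s z≤n) 5≤n
  v₀ = fromℕ< 1≤n
  upper : a + b ≤ 2 * n
  upper = at-most-double (chromatic-≤-order G χG) (chromatic-≤-order (compl G) χG')
  -- If G or its complement has degree above n/2, it needs n colours and the other at least one.
  dense : n < 2 * k ⊎ 2 * k + 2 < n → suc n ≤ a + b
  dense (inj₁ n<2k) = dense-pair G regular (compl G) 1≤n (subst (n <_) (twice k) n<2k) colG (g , colG')
  dense (inj₂ 2k+2<n) with sparse-complement-dense G regular v₀ 2k+2<n
  ... | regular' , n<2d =
    subst (suc n ≤_) (+-comm b a) (dense-pair (compl G) regular' G 1≤n n<2d colG' (f , colG))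
  balanced : 2 * k ≡ n ⊎ 2 * k + 2 ≡ n → n ≤ a + b
  balanced (inj₁ 2k≡n) = Balanced.balanced-bound c regular half (half-≥3 half 5≤n) v₀ colG colG'
    where half = trans (sym (twice k)) 2k≡n
  balanced (inj₂ 2k+2≡n) with near-half-complement G regular 2k+2≡n
  ... | regular' , half = subst (n ≤_) (+-comm b a)
          (Balanced.balanced-bound (isComplement-sym c) regular' half (half-≥3 half 5≤n) v₀ colG' colG)
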